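{- For every natural number $n>1$ there exists a (finite, simple, connected) graph $G$ with $r_\Delta(G)=n$.
   Context: For a graph $G=(V,E)$ and $S\subseteq V$, the $\Delta$-interval $[S]$ is the set consisting of all vertices of $S$ together with every vertex $v\in V$ adjacent to both $x$ and $y$ for some pair of adjacent vertices $x,y\in S$. A set $S$ is $\Delta$-convex if $[S]=S$, and $\langle S\rangle$ denotes the smallest $\Delta$-convex set containing $S$ ($\langle\emptyset\rangle=\emptyset$). A set $S$ is Radon dependent if there is a partition $\{S_1,S_2\}$ of $S$ with $\langle S_1\rangle\cap\langle S_2\rangle\neq\emptyset$, and Radon independent otherwise. The Radon number $r_\Delta(G)$ is the least integer $n\ge0$ such that every $S\subseteq V$ with $|S|>n$ is Radon dependent (equivalently, the maximum size of a Radon independent set). -}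

module Defs where

open import Data.Nat using (ℕ; zero; suc; _<_; _≤_)
open import Data.Bool using (Bool; true; false)
open import Data.Fin using (Fin)
open import Data.Fin.Subset using (Subset; _∈_; _∉_; ∣_∣)
open import Data.Product using (Σ; ∃; _×_; _,_)
open import Data.Sum using (_⊎_)
open import Relation.Binary.PropositionalEquality using (_≡_)
open import Relation.Nullary using (¬_)

record Graph (k : ℕ) : Set where
  field
    adj     : Fin k → Fin k → Bool
    symm    : ∀ u v → adj u v ≡ adj v u
    irrefl  : ∀ u → adj u u ≡ false

module _ {k : ℕ} (G : Graph k) where
  open Graph G

  Adj : Fin k → Fin k → Set
  Adj u v = adj u v ≡ true

  data Walk : Fin k → Fin k → Set where
    here : ∀ {u} → Walk u u
    step : ∀ {u v w} → Adj u v → Walk v w → Walk u w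

  Connected : Set
  Connected = ∀ u v → Walk u v

  _∈Δ[_] : Fin k → Subset k → Set
  v ∈Δ[ S ] = v ∈ S ⊎ (Σ (Fin k) λ x → Σ (Fin k) λ y →
                x ∈ S × y ∈ S × Adj x y × Adj v x × Adj v y)

  -- S is Δ-convex iff [S] = S (S ⊆ [S] always holds)
  IsΔConvex : Subset k → Set
  IsΔConvex S = ∀ v → v ∈Δ[ S ] → v ∈ S

  _∈⟨_⟩ : Fin k → Subset k → Set
  v ∈⟨ S ⟩ = ∀ (C : Subset k) → (∀ u → u ∈ S → u ∈ C) → IsΔConvex C → v ∈ C

  IsPartition : Subset k → Subset k → Subset k → Set
  IsPartition S S₁ S₂ =
    (∀ v → v ∈ S → v ∈ S₁ ⊎ v ∈ S₂) ×
    (∀ v → v ∈ S₁ → v ∈ S) ×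
    (∀ v → v ∈ S₂ → v ∈ S) ×
    (∀ v → v ∈ S₁ → v ∉ S₂)

  RadonDependent : Subset k → Set
  RadonDependent S = Σ (Subset k) λ S₁ → Σ (Subset k) λ S₂ →
    IsPartition S S₁ S₂ × Σ (Fin k) λ v → v ∈⟨ S₁ ⟩ × v ∈⟨ S₂ ⟩

  RadonIndependent : Subset k → Set
  RadonIndependent S = ¬ RadonDependent S

  RadonBound : ℕ → Set
  RadonBound m = ∀ (S : Subset k) → m < ∣ S ∣ → RadonDependent S

  RadonNumberIs : ℕ → Set
  RadonNumberIs r = RadonBound r × (∀ m → RadonBound m → r ≤ m)

module Submission where

open import Defs
open import Data.Nat using (ℕ; _<_; _≤_; suc)
open import Data.Nat.Properties using (≤⇒≯; ≮⇒≥)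
open import Data.Product using (Σ; _×_; _,_)
open import Data.Sum using (inj₁; inj₂)
open import Data.Bool using (Bool; true; false; _xor_)
open import Data.Bool.Properties using (xor-comm; xor-same)
open import Data.Fin using (Fin; zero; suc)
open import Data.Fin.Subset using (_∈_; ∣_∣; ⊤)
open import Data.Fin.Subset.Properties using (∣p∣≤n; ∣⊤∣≡n)
open import Relation.Binary.PropositionalEquality using (_≡_; refl; subst)
open import Relation.Nullary using (¬_; contradiction)

-- In a triangle-free graph the Δ-interval operator is the identity, so every
-- set is its own Δ-hull and no partition can make two hulls meet: the whole
-- vertex set is Radon independent and r_Δ equals the number of vertices.
-- The star K₁,ₙ₋₁ is a connected triangle-free graph on n vertices.

TriangleFree : ∀ {k} → Graph k → Set
TriangleFree G = ∀ u v w → Adj G u v → Adj G u w → ¬ Adj G v w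

∈⟨⟩⇒∈ : ∀ {k} (G : Graph k) {S v} → IsΔConvex G S → _∈⟨_⟩ G v S → v ∈ S
∈⟨⟩⇒∈ G convex v∈⟨S⟩ = v∈⟨S⟩ _ (λ _ u∈S → u∈S) convex

triangleFree⇒ΔConvex : ∀ {k} (G : Graph k) → TriangleFree G → ∀ S → IsΔConvex G S
triangleFree⇒ΔConvex G noTriangle S v (inj₁ v∈S) = v∈S
triangleFree⇒ΔConvex G noTriangle S v (inj₂ (x , y , _ , _ , x~y , v~x , v~y)) =
  contradiction x~y (noTriangle v x y v~x v~y)

triangleFree⇒RadonIndependent : ∀ {k} (G : Graph k) → TriangleFree G →
                                ∀ S → RadonIndependent G S
triangleFree⇒RadonIndependent G noTriangle S
  (S₁ , S₂ , (_ , _ , _ , disjoint) , v , v∈⟨S₁⟩ , v∈⟨S₂⟩) =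
  disjoint v (∈⟨⟩⇒∈ G (convex S₁) v∈⟨S₁⟩) (∈⟨⟩⇒∈ G (convex S₂) v∈⟨S₂⟩)
  where
  convex : ∀ T → IsΔConvex G T
  convex = triangleFree⇒ΔConvex G noTriangle

radonIndependent⇒∣S∣≤bound : ∀ {k} (G : Graph k) {S m} →
                             RadonIndependent G S → RadonBound G m → ∣ S ∣ ≤ m
radonIndependent⇒∣S∣≤bound G {S} independent bound =
  ≮⇒≥ (λ m<∣S∣ → independent (bound S m<∣S∣))

radonBound-vertexCount : ∀ {k} (G : Graph k) → RadonBound G k
radonBound-vertexCount G S k<∣S∣ = contradiction k<∣S∣ (≤⇒≯ (∣p∣≤n S))

radonIndependent-⊤⇒radonNumberIs-vertexCount : ∀ {k} (G : Graph k) →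
  RadonIndependent G ⊤ → RadonNumberIs G k
radonIndependent-⊤⇒radonNumberIs-vertexCount {k} G independent =
  radonBound-vertexCount G ,
  λ m bound → subst (_≤ m) (∣⊤∣≡n k) (radonIndependent⇒∣S∣≤bound G independent bound)

completeBipartite : ∀ {k} → (Fin k → Bool) → Graph k
completeBipartite colour = record
  { adj    = λ u v → colour u xor colour v
  ; symm   = λ u v → xor-comm (colour u) (colour v)
  ; irrefl = λ u → xor-same (colour u)
  }

xor-noTriangle : ∀ a b c → a xor b ≡ true → a xor c ≡ true → ¬ (b xor c ≡ true)
xor-noTriangle false true  true  _ _ ()
xor-noTriangle true  false false _ _ ()

completeBipartite-triangleFree : ∀ {k} (colour : Fin k → Bool) →
                                 TriangleFree (completeBipartite colour)
completeBipartite-triangleFree colour u v w =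
  xor-noTriangle (colour u) (colour v) (colour w)

isCentre : ∀ {k} → Fin k → Bool
isCentre zero    = true
isCentre (suc _) = false

star : ∀ k → Graph k
star k = completeBipartite isCentre

star-connected : ∀ {k} → Connected (star k)
star-connected zero    v = fromCentre v
  where
  fromCentre : ∀ {m} (v : Fin (suc m)) → Walk (star (suc m)) zero v
  fromCentre zero    = here
  fromCentre (suc _) = step refl here
star-connected (suc _) v = step refl (star-connected zero v)

proposition2 : ∀ (n : ℕ) → 1 < n →
    Σ ℕ λ k → Σ (Graph k) λ G → Connected G × RadonNumberIs G n
proposition2 n _ =
  n , star n , star-connected ,
  radonIndependent-⊤⇒radonNumberIs-vertexCount (star n)
    (triangleFree⇒RadonIndependent (star n) (completeBipartite-triangleFree isCentre) ⊤)
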